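{- Consider an element $w$ during the execution of DLM. Suppose the position $\pi(w)$ of $w$ on DLM's list increases by exactly $1$, while $b(w)$ and $\pi^*(w)$ stay unchanged. Then $\Delta\Phi_w+\Delta\Psi_w\le 0$ if $w$ was safe before the movement, and $\Delta\Phi_w+\Delta\Psi_w\le 3\beta$ otherwise.
   Context: Online Min-Sum Set Cover with requests of cardinality at most $r$, over a universe $\mathcal U$ of $n$ elements. Lists are permutations $\mathcal U\to\{1,\dots,n\}$. Algorithm DLM. Every element $z$ has a budget $b(z)$, initially $0$. The operation fetch$(z)$ moves $z$ to position 1 by $\pi(z)-1$ adjacent swaps, so every element that preceded $z$ moves back by one position, and then sets $b(z)\gets0$. On a request $R$ with $|R|=s$, let $x\in R$ be the element of $R$ with the smallest current position and let $\ell=\pi(x)$. DLM pays $\ell$ and executes fetch$(x)$. For every $y\in R\setminus\{x\}$ it sets $b(y)\gets b(y)+\ell/s$. Then, while some $z$ has $b(z)\ge\pi(z)$, it executes fetch$(z)$. Potentials. Let $\pi$ be DLM's current permutation and $\pi^*$ the current permutation of an arbitrary offline algorithm Off. Write $\pi(z)=2^{p(z)}+q(z)$ with $p(z)\ge0$ an integer and $0\le q(z)\le 2^{p(z)}-1$, and analogously $\pi^*(z)=2^{p^*(z)}+q^*(z)$. Set $\alpha=2$, $\gamma=5r$, $\beta=7.5r+5$ and $\kappa=\lceil\log_2(6\beta)\rceil$. Define - $\Phi_z=\alpha\, b(z)$ if $p(z)\le p^*(z)+\kappa$, and $\Phi_z=\beta\,\pi(z)-\gamma\, b(z)$ if $p(z)\ge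 p^*(z)+\kappa+1$; - $\Psi_z=0$ if $p(z)\le p^*(z)+\kappa-1$, and $\Psi_z=2\beta\, q(z)$ if $p(z)\ge p^*(z)+\kappa$. An element $w$ is safe if $p(w)\le p^*(w)+\kappa-1$, and unsafe otherwise. $\Delta$ denotes the change of a quantity caused by the movement. -}

module Defs where

open import Data.Bool using (Bool; true; false; if_then_else_)
open import Data.Nat as ℕ using (ℕ; suc; _+_; _*_; _∸_; _^_; _≤ᵇ_)
open import Data.Nat.Logarithm using (⌊log₂_⌋; ⌈log₂_⌉)
open import Data.Integer using (+_)
open import Data.Rational as ℚ using (ℚ; _/_)
open import Relation.Nullary using (¬_)
open import Relation.Binary.PropositionalEquality using (_≡_)

⟦_⟧ : ℕ → ℚ
⟦ n ⟧ = + n / 1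

-- decomposition of a position π ≥ 1 as π = 2^p + q with 0 ≤ q ≤ 2^p - 1
pexp : ℕ → ℕ
pexp π = ⌊log₂ π ⌋

qrem : ℕ → ℕ
qrem π = π ∸ 2 ^ pexp π

-- constants (r = maximum request cardinality)
α : ℚ
α = ⟦ 2 ⟧

γ : ℕ → ℚ
γ r = ⟦ 5 * r ⟧

-- β = 7.5 r + 5 = (15 r + 10) / 2
β : ℕ → ℚ
β r = + (15 * r + 10) / 2

-- 6β = 45 r + 30 is a natural number; κ = ⌈log₂ (6β)⌉
sixβ : ℕ → ℕ
sixβ r = 45 * r + 30

κ : ℕ → ℕ
κ r = ⌈log₂ sixβ r ⌉

Φ : ℕ → ℕ → ℕ → ℚ → ℚ
Φ r π πs b =
  if pexp π ≤ᵇ pexp πs + κ r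
  then α ℚ.* b
  else (β r ℚ.* ⟦ π ⟧) ℚ.- (γ r ℚ.* b)

Ψ : ℕ → ℕ → ℕ → ℚ
Ψ r π πs =
  if pexp π ℕ.+ 1 ≤ᵇ pexp πs + κ r
  then ⟦ 0 ⟧
  else ⟦ 2 ⟧ ℚ.* β r ℚ.* ⟦ qrem π ⟧

-- w is safe iff p(w) ≤ p*(w) + κ - 1, i.e. p(w) + 1 ≤ p*(w) + κ
Safe : ℕ → ℕ → ℕ → Set
Safe r π πs = pexp π ℕ.+ 1 ℕ.≤ pexp πs + κ r

ΔΦΨ : ℕ → ℕ → ℕ → ℚ → ℚ
ΔΦΨ r π πs b =
  (Φ r (suc π) πs b ℚ.- Φ r π πs b) ℚ.+ (Ψ r (suc π) πs ℚ.- Ψ r π πs)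

{-# OPTIONS --safe #-}
-- If π + 1 stays in the dyadic block [2^p, 2^(p+1)) of π, then p is unchanged and q grows by 1,
-- so neither potential changes regime: ΔΦ is 0 or β and ΔΨ is 0 or 2β, and both vanish while w
-- is safe.  If π + 1 = 2^(p+1), then q drops from 2^p - 1 to 0, and the 2βq released by Ψ pays
-- for Φ possibly switching to βπ - γb, because then π + 1 = 2(q + 1).
module Submission where

open import Defs
open import Data.Nat using (ℕ; _≤_)
open import Data.Rational using (ℚ; 0ℚ) renaming (_≤_ to _≤ℚ_; _*_ to _*ℚ_)
open import Data.Product using (_×_)
open import Relation.Nullary using (¬_)

open import Data.Bool.Base using (true; false; if_then_else_)
open import Data.Product using (_,_)
open import Data.Nat.Base
  using (suc; zero; _+_; _*_; _^_; _∸_; _<_; _≤ᵇ_; ⌊_/2⌋; NonZero; >-nonZero; z≤n; s≤s)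
open import Data.Nat.Properties
  using ( ≤-refl; ≤-trans; ≤-antisym; <-≤-trans; <-irrefl; ≮⇒≥
        ; _<?_; _≤?_; n≤1+n; m≤m+n; m^n>0; *-suc; *-monoʳ-≤; ^-monoʳ-≤
        ; +-comm; +-suc; +-identityʳ; +-cancelˡ-≡; +-∸-assoc; m+[n∸m]≡n; m≤n⇒m∸n≡0
        ; +-monoˡ-≤; ≤ᵇ-reflects-≤ )
open import Data.Nat.Logarithm using (⌊log₂_⌋; ⌊log₂⌋-mono-≤; ⌊log₂[2^n]⌋≡n)
open import Data.Nat.Logarithm.Core using (⌊log2⌋)
open import Data.Nat.Coprimality using (1-coprimeTo) renaming (sym to coprime-sym)
open import Induction.WellFounded using (Acc; acc)
import Data.Integer as ℤ
import Data.Integer.Properties as ℤₚ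
open import Data.Rational using (1ℚ; mkℚ; _/_) renaming (_+_ to _+ℚ_; _-_ to _-ℚ_)
open import Data.Rational.Properties
  using ( normalize-coprime; normalize-nonNeg; nonNegative⁻¹; nonNeg*nonNeg⇒nonNeg
        ; +-monoʳ-≤; neg-antimono-≤; *-zeroʳ; +-inverseʳ )
  renaming ( +-identityʳ to +ℚ-identityʳ; +-mono-≤ to +ℚ-mono-≤
           ; ≤-refl to ≤ℚ-refl; ≤-reflexive to ≤ℚ-reflexive )
open import Data.Rational.Base using (nonNegative)
open import Data.Rational.Solver using (module +-*-Solver)
open +-*-Solver using (solve; _:+_; _:*_; _:-_; con; _:=_)
open import Relation.Nullary using (Dec; yes; no; contradiction)
open import Relation.Nullary.Reflects using (ofʸ; ofⁿ)
open import Relation.Binary.PropositionalEquality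
  using (_≡_; refl; sym; trans; cong; cong₂; subst; module ≡-Reasoning)

2*⌊n/2⌋≤n : ∀ n → 2 * ⌊ n /2⌋ ≤ n
2*⌊n/2⌋≤n zero          = z≤n
2*⌊n/2⌋≤n (suc zero)    = z≤n
2*⌊n/2⌋≤n (suc (suc n)) =
  subst (_≤ 2 + n) (sym (*-suc 2 ⌊ n /2⌋)) (s≤s (s≤s (2*⌊n/2⌋≤n n)))

n<2*[1+⌊n/2⌋] : ∀ n → n < 2 * suc ⌊ n /2⌋
n<2*[1+⌊n/2⌋] zero          = s≤s z≤n
n<2*[1+⌊n/2⌋] (suc zero)    = s≤s (s≤s z≤n)
n<2*[1+⌊n/2⌋] (suc (suc n)) =
  subst (2 + n <_) (sym (*-suc 2 (suc ⌊ n /2⌋))) (s≤s (s≤s (n<2*[1+⌊n/2⌋] n)))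

2^⌊log2⌋≤n : ∀ n (rec : Acc _<_ (suc n)) → 2 ^ ⌊log2⌋ (suc n) rec ≤ suc n
2^⌊log2⌋≤n zero    _        = ≤-refl
2^⌊log2⌋≤n (suc n) (acc rs) =
  ≤-trans (*-monoʳ-≤ 2 (2^⌊log2⌋≤n ⌊ n /2⌋ _)) (2*⌊n/2⌋≤n (suc (suc n)))

n<2^[1+⌊log2⌋] : ∀ n (rec : Acc _<_ n) → n < 2 ^ suc (⌊log2⌋ n rec)
n<2^[1+⌊log2⌋] zero          _        = s≤s z≤n
n<2^[1+⌊log2⌋] (suc zero)    _        = s≤s (s≤s z≤n)
n<2^[1+⌊log2⌋] (suc (suc n)) (acc rs) =
  <-≤-trans (n<2*[1+⌊n/2⌋] (suc (suc n))) (*-monoʳ-≤ 2 (n<2^[1+⌊log2⌋] (suc ⌊ n /2⌋) _))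

2^⌊log₂n⌋≤n : ∀ n .{{_ : NonZero n}} → 2 ^ ⌊log₂ n ⌋ ≤ n
2^⌊log₂n⌋≤n (suc n) = 2^⌊log2⌋≤n n _

n<2^[1+⌊log₂n⌋] : ∀ n → n < 2 ^ suc ⌊log₂ n ⌋
n<2^[1+⌊log₂n⌋] n = n<2^[1+⌊log2⌋] n _

⌊log₂⌋-unique : ∀ {n k} → 2 ^ k ≤ n → n < 2 ^ suc k → ⌊log₂ n ⌋ ≡ k
⌊log₂⌋-unique {n} {k} lo hi = ≤-antisym (≮⇒≥ k≮⌊log₂n⌋) k≤⌊log₂n⌋
  where
  instance
    n≢0 : NonZero n
    n≢0 = >-nonZero (≤-trans (m^n>0 2 k) lo)
  k≮⌊log₂n⌋ : ¬ k < ⌊log₂ n ⌋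
  k≮⌊log₂n⌋ k< = <-irrefl refl (<-≤-trans hi (≤-trans (^-monoʳ-≤ 2 k<) (2^⌊log₂n⌋≤n n)))
  k≤⌊log₂n⌋ : k ≤ ⌊log₂ n ⌋
  k≤⌊log₂n⌋ = subst (_≤ ⌊log₂ n ⌋) (⌊log₂[2^n]⌋≡n k) (⌊log₂⌋-mono-≤ lo)

1+[n∸m]≡m : ∀ {m n} → m ≤ n → suc n ≡ m + m → suc (n ∸ m) ≡ m
1+[n∸m]≡m {m} {n} m≤n eq =
  +-cancelˡ-≡ m _ _ (trans (+-suc m (n ∸ m)) (trans (cong suc (m+[n∸m]≡n m≤n)) eq))

data Step (n : ℕ) : Set where
  within : pexp (suc n) ≡ pexp n → qrem (suc n) ≡ suc (qrem n) → Step n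
  carry  : pexp (suc n) ≡ pexp n + 1 → qrem (suc n) ≡ 0 →
           suc n ≡ suc (qrem n) + suc (qrem n) → Step n

step : ∀ n .{{_ : NonZero n}} → Step n
step n with suc n <? 2 ^ suc (pexp n)
... | yes n+1<2^[P+1] = within pexp≡ qrem≡
  where
  pexp≡ : pexp (suc n) ≡ pexp n
  pexp≡ = ⌊log₂⌋-unique (≤-trans (2^⌊log₂n⌋≤n n) (n≤1+n n)) n+1<2^[P+1]
  qrem≡ : qrem (suc n) ≡ suc (qrem n)
  qrem≡ = trans (cong (λ p → suc n ∸ 2 ^ p) pexp≡) (+-∸-assoc 1 (2^⌊log₂n⌋≤n n))
... | no n+1≮2^[P+1] = carry (trans pexp≡ (+-comm 1 (pexp n))) qrem≡ halves
  where
  t = 2 ^ pexp n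
  n+1≡2t : suc n ≡ 2 * t
  n+1≡2t = ≤-antisym (n<2^[1+⌊log₂n⌋] n) (≮⇒≥ n+1≮2^[P+1])
  n+1≡t+t : suc n ≡ t + t
  n+1≡t+t = trans n+1≡2t (cong (t +_) (+-identityʳ t))
  pexp≡ : pexp (suc n) ≡ suc (pexp n)
  pexp≡ = trans (cong ⌊log₂_⌋ n+1≡2t) (⌊log₂[2^n]⌋≡n (suc (pexp n)))
  qrem≡ : qrem (suc n) ≡ 0
  qrem≡ = m≤n⇒m∸n≡0 (subst (λ p → suc n ≤ 2 ^ p) (sym pexp≡) (n<2^[1+⌊log₂n⌋] n))
  halves : suc n ≡ suc (qrem n) + suc (qrem n)
  halves = trans n+1≡t+t (sym (cong₂ _+_ q+1≡t q+1≡t))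
    where q+1≡t = 1+[n∸m]≡m (2^⌊log₂n⌋≤n n) n+1≡t+t

⟦⟧≡mkℚ : ∀ n → ⟦ n ⟧ ≡ mkℚ (ℤ.+ n) 0 (coprime-sym (1-coprimeTo n))
⟦⟧≡mkℚ n = normalize-coprime (coprime-sym (1-coprimeTo n))

⟦⟧-+ : ∀ m n → ⟦ m + n ⟧ ≡ ⟦ m ⟧ +ℚ ⟦ n ⟧
⟦⟧-+ m n = begin
  ℤ.+ (m + n) / 1
    ≡⟨ cong (_/ 1) (ℤₚ.pos-+ m n) ⟩
  (ℤ.+ m ℤ.+ ℤ.+ n) / 1
    ≡⟨ cong (_/ 1) (sym (cong₂ ℤ._+_ (ℤₚ.*-identityʳ (ℤ.+ m)) (ℤₚ.*-identityʳ (ℤ.+ n)))) ⟩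
  (ℤ.+ m ℤ.* ℤ.1ℤ ℤ.+ ℤ.+ n ℤ.* ℤ.1ℤ) / 1
    ≡⟨ sym (cong₂ _+ℚ_ (⟦⟧≡mkℚ m) (⟦⟧≡mkℚ n)) ⟩
  ⟦ m ⟧ +ℚ ⟦ n ⟧ ∎
  where open ≡-Reasoning

0≤⟦n⟧ : ∀ n → 0ℚ ≤ℚ ⟦ n ⟧
0≤⟦n⟧ n = nonNegative⁻¹ ⟦ n ⟧ {{normalize-nonNeg n 1}}

0≤β : ∀ r → 0ℚ ≤ℚ β r
0≤β r = nonNegative⁻¹ (β r) {{normalize-nonNeg (15 * r + 10) 2}}

0≤p*q : ∀ {p q} → 0ℚ ≤ℚ p → 0ℚ ≤ℚ q → 0ℚ ≤ℚ p *ℚ q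
0≤p*q {p} {q} 0≤p 0≤q =
  nonNegative⁻¹ (p *ℚ q) {{nonNeg*nonNeg⇒nonNeg p {{nonNegative 0≤p}} q {{nonNegative 0≤q}}}}

p≡q-s⇒p≤q : ∀ {p q s} → p ≡ q -ℚ s → 0ℚ ≤ℚ s → p ≤ℚ q
p≡q-s⇒p≤q {q = q} refl 0≤s =
  subst (q -ℚ _ ≤ℚ_) (+ℚ-identityʳ q) (+-monoʳ-≤ q (neg-antimono-≤ 0≤s))

if-≤ᵇ-≤ : ∀ {a} {A : Set a} {m n} {x y : A} → m ≤ n → (if m ≤ᵇ n then x else y) ≡ x
if-≤ᵇ-≤ {m = m} {n} m≤n with m ≤ᵇ n | ≤ᵇ-reflects-≤ m n
... | true  | _        = refl
... | false | ofⁿ m≰n = contradiction m≤n m≰n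

if-≤ᵇ-≰ : ∀ {a} {A : Set a} {m n} {x y : A} → ¬ m ≤ n → (if m ≤ᵇ n then x else y) ≡ y
if-≤ᵇ-≰ {m = m} {n} m≰n with m ≤ᵇ n | ≤ᵇ-reflects-≤ m n
... | false | _        = refl
... | true  | ofʸ m≤n = contradiction m≤n m≰n

pexp-mono : ∀ π → pexp π ≤ pexp (suc π)
pexp-mono π = ⌊log₂⌋-mono-≤ (n≤1+n π)

module _ (r πs : ℕ) where

  K : ℕ
  K = pexp πs + κ r

  Φ-low : ∀ π b → pexp π ≤ K → Φ r π πs b ≡ α *ℚ b
  Φ-low π b = if-≤ᵇ-≤

  Φ-high : ∀ π b → ¬ pexp π ≤ K → Φ r π πs b ≡ β r *ℚ ⟦ π ⟧ -ℚ γ r *ℚ b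
  Φ-high π b = if-≤ᵇ-≰

  Ψ-safe : ∀ π → Safe r π πs → Ψ r π πs ≡ 0ℚ
  Ψ-safe π = if-≤ᵇ-≤

  Ψ-unsafe : ∀ π → ¬ Safe r π πs → Ψ r π πs ≡ ⟦ 2 ⟧ *ℚ β r *ℚ ⟦ qrem π ⟧
  Ψ-unsafe π = if-≤ᵇ-≰

  Ψ-qrem≡0 : ∀ π → qrem π ≡ 0 → Ψ r π πs ≡ 0ℚ
  Ψ-qrem≡0 π qrem≡0 with pexp π + 1 ≤ᵇ K
  ... | true  = refl
  ... | false = trans (cong (λ q → ⟦ 2 ⟧ *ℚ β r *ℚ ⟦ q ⟧) qrem≡0) (*-zeroʳ (⟦ 2 ⟧ *ℚ β r))

  ΔΦ : ℕ → ℚ → ℚ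
  ΔΦ π b = Φ r (suc π) πs b -ℚ Φ r π πs b

  ΔΨ : ℕ → ℚ
  ΔΨ π = Ψ r (suc π) πs -ℚ Ψ r π πs

  ΔΦ-low : ∀ π b → pexp (suc π) ≤ K → ΔΦ π b ≡ 0ℚ
  ΔΦ-low π b low =
    trans (cong₂ _-ℚ_ (Φ-low (suc π) b low) (Φ-low π b (≤-trans (pexp-mono π) low)))
          (+-inverseʳ (α *ℚ b))

  ΔΦ-high : ∀ π b → ¬ pexp π ≤ K → ΔΦ π b ≡ β r
  ΔΦ-high π b high = begin
    ΔΦ π b
      ≡⟨ cong₂ _-ℚ_ (Φ-high (suc π) b (λ low → high (≤-trans (pexp-mono π) low)))
                    (Φ-high π b high) ⟩
    (β r *ℚ ⟦ 1 + π ⟧ -ℚ γ r *ℚ b) -ℚ (β r *ℚ ⟦ π ⟧ -ℚ γ r *ℚ b)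
      ≡⟨ cong (λ x → (β r *ℚ x -ℚ γ r *ℚ b) -ℚ (β r *ℚ ⟦ π ⟧ -ℚ γ r *ℚ b)) (⟦⟧-+ 1 π) ⟩
    (β r *ℚ (1ℚ +ℚ ⟦ π ⟧) -ℚ γ r *ℚ b) -ℚ (β r *ℚ ⟦ π ⟧ -ℚ γ r *ℚ b)
      ≡⟨ solve 4 (λ B G b p → (B :* (con 1ℚ :+ p) :- G :* b) :- (B :* p :- G :* b) := B)
               refl (β r) (γ r) b ⟦ π ⟧ ⟩
    β r ∎
    where open ≡-Reasoning

  ΔΦ-crossing : ∀ π b → pexp π ≤ K → ¬ pexp (suc π) ≤ K →
                suc π ≡ suc (qrem π) + suc (qrem π) →
                ΔΦ π b ≡ (β r *ℚ ((1ℚ +ℚ ⟦ qrem π ⟧) +ℚ (1ℚ +ℚ ⟦ qrem π ⟧)) -ℚ γ r *ℚ b) -ℚ α *ℚ b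
  ΔΦ-crossing π b low high halves = begin
    ΔΦ π b
      ≡⟨ cong₂ _-ℚ_ (Φ-high (suc π) b high) (Φ-low π b low) ⟩
    (β r *ℚ ⟦ suc π ⟧ -ℚ γ r *ℚ b) -ℚ α *ℚ b
      ≡⟨ cong (λ x → (β r *ℚ x -ℚ γ r *ℚ b) -ℚ α *ℚ b) ⟦π+1⟧≡ ⟩
    (β r *ℚ ((1ℚ +ℚ ⟦ qrem π ⟧) +ℚ (1ℚ +ℚ ⟦ qrem π ⟧)) -ℚ γ r *ℚ b) -ℚ α *ℚ b ∎
    where
    open ≡-Reasoning
    ⟦π+1⟧≡ : ⟦ suc π ⟧ ≡ (1ℚ +ℚ ⟦ qrem π ⟧) +ℚ (1ℚ +ℚ ⟦ qrem π ⟧)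
    ⟦π+1⟧≡ = begin
      ⟦ suc π ⟧                           ≡⟨ cong ⟦_⟧ halves ⟩
      ⟦ suc (qrem π) + suc (qrem π) ⟧     ≡⟨ ⟦⟧-+ (suc (qrem π)) (suc (qrem π)) ⟩
      ⟦ 1 + qrem π ⟧ +ℚ ⟦ 1 + qrem π ⟧    ≡⟨ cong₂ _+ℚ_ (⟦⟧-+ 1 (qrem π)) (⟦⟧-+ 1 (qrem π)) ⟩
      (1ℚ +ℚ ⟦ qrem π ⟧) +ℚ (1ℚ +ℚ ⟦ qrem π ⟧) ∎

  ΔΨ-safe : ∀ π → Safe r π πs → Ψ r (suc π) πs ≡ 0ℚ → ΔΨ π ≡ 0ℚ
  ΔΨ-safe π safe Ψ[π+1]≡0 = cong₂ _-ℚ_ Ψ[π+1]≡0 (Ψ-safe π safe)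

  ΔΨ-within : ∀ π → ¬ Safe r π πs → qrem (suc π) ≡ suc (qrem π) → ΔΨ π ≡ ⟦ 2 ⟧ *ℚ β r
  ΔΨ-within π unsafe qrem≡ = begin
    ΔΨ π
      ≡⟨ cong₂ _-ℚ_ (Ψ-unsafe (suc π) unsafe′) (Ψ-unsafe π unsafe) ⟩
    ⟦ 2 ⟧ *ℚ β r *ℚ ⟦ qrem (suc π) ⟧ -ℚ ⟦ 2 ⟧ *ℚ β r *ℚ ⟦ qrem π ⟧
      ≡⟨ cong (λ x → ⟦ 2 ⟧ *ℚ β r *ℚ x -ℚ ⟦ 2 ⟧ *ℚ β r *ℚ ⟦ qrem π ⟧)
              (trans (cong ⟦_⟧ qrem≡) (⟦⟧-+ 1 (qrem π))) ⟩
    ⟦ 2 ⟧ *ℚ β r *ℚ (1ℚ +ℚ ⟦ qrem π ⟧) -ℚ ⟦ 2 ⟧ *ℚ β r *ℚ ⟦ qrem π ⟧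
      ≡⟨ solve 2 (λ B q → con ⟦ 2 ⟧ :* B :* (con 1ℚ :+ q) :- con ⟦ 2 ⟧ :* B :* q := con ⟦ 2 ⟧ :* B)
               refl (β r) ⟦ qrem π ⟧ ⟩
    ⟦ 2 ⟧ *ℚ β r ∎
    where
    open ≡-Reasoning
    unsafe′ : ¬ Safe r (suc π) πs
    unsafe′ safe′ = unsafe (≤-trans (+-monoˡ-≤ 1 (pexp-mono π)) safe′)

  ΔΨ-carry : ∀ π → ¬ Safe r π πs → qrem (suc π) ≡ 0 → ΔΨ π ≡ 0ℚ -ℚ ⟦ 2 ⟧ *ℚ β r *ℚ ⟦ qrem π ⟧
  ΔΨ-carry π unsafe qrem≡0 = cong₂ _-ℚ_ (Ψ-qrem≡0 (suc π) qrem≡0) (Ψ-unsafe π unsafe)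

  ΔΦΨ-safe : ∀ π b .{{_ : NonZero π}} → Safe r π πs → ΔΦΨ r π πs b ≡ 0ℚ
  ΔΦΨ-safe π b safe = by-cases (step π)
    -- a `with` on this goal would make Agda normalise the rational potentials, which is very slow
    where
    by-cases : Step π → ΔΦΨ r π πs b ≡ 0ℚ
    by-cases (within pexp≡ _) =
      cong₂ _+ℚ_ (ΔΦ-low π b (subst (_≤ K) (sym pexp≡) (≤-trans (m≤m+n (pexp π) 1) safe)))
                 (ΔΨ-safe π safe (Ψ-safe (suc π) (subst (λ p → p + 1 ≤ K) (sym pexp≡) safe)))
    by-cases (carry pexp≡ qrem≡0 _) =
      cong₂ _+ℚ_ (ΔΦ-low π b (subst (_≤ K) (sym pexp≡) safe))
                 (ΔΨ-safe π safe (Ψ-qrem≡0 (suc π) qrem≡0))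

  ΔΦΨ-unsafe : ∀ π b .{{_ : NonZero π}} → 0ℚ ≤ℚ b → ¬ Safe r π πs →
               ΔΦΨ r π πs b ≤ℚ ⟦ 3 ⟧ *ℚ β r
  ΔΦΨ-unsafe π b 0≤b unsafe = by-cases (step π) (pexp π ≤? K)
    where
    by-cases : Step π → Dec (pexp π ≤ K) → ΔΦΨ r π πs b ≤ℚ ⟦ 3 ⟧ *ℚ β r
    by-cases (within pexp≡ qrem≡) (yes low) =
      p≡q-s⇒p≤q (trans (cong₂ _+ℚ_ (ΔΦ-low π b (subst (_≤ K) (sym pexp≡) low))
                                   (ΔΨ-within π unsafe qrem≡))
                       (solve 1 (λ B → con 0ℚ :+ con ⟦ 2 ⟧ :* B := con ⟦ 3 ⟧ :* B :- B) refl (β r)))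
                (0≤β r)
    by-cases (within _ qrem≡) (no high) =
      p≡q-s⇒p≤q (trans (cong₂ _+ℚ_ (ΔΦ-high π b high) (ΔΨ-within π unsafe qrem≡))
                       (solve 1 (λ B → B :+ con ⟦ 2 ⟧ :* B := con ⟦ 3 ⟧ :* B :- con 0ℚ) refl (β r)))
                ≤ℚ-refl
    by-cases (carry pexp≡ qrem≡0 halves) (yes low) =
      p≡q-s⇒p≤q (trans (cong₂ _+ℚ_ (ΔΦ-crossing π b low (λ high → unsafe (subst (_≤ K) pexp≡ high))
                                                 halves)
                                   (ΔΨ-carry π unsafe qrem≡0))
                       (solve 5 (λ A B G b q → ((B :* ((con 1ℚ :+ q) :+ (con 1ℚ :+ q)) :- G :* b) :- A :* b)
                                                 :+ (con 0ℚ :- con ⟦ 2 ⟧ :* B :* q)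
                                               := con ⟦ 3 ⟧ :* B :- (B :+ (G :+ A) :* b))
                              refl α (β r) (γ r) b ⟦ qrem π ⟧))
                (+ℚ-mono-≤ (0≤β r) (0≤p*q (+ℚ-mono-≤ (0≤⟦n⟧ (5 * r)) (0≤⟦n⟧ 2)) 0≤b))
    by-cases (carry _ qrem≡0 _) (no high) =
      p≡q-s⇒p≤q (trans (cong₂ _+ℚ_ (ΔΦ-high π b high) (ΔΨ-carry π unsafe qrem≡0))
                       (solve 2 (λ B q → B :+ (con 0ℚ :- con ⟦ 2 ⟧ :* B :* q)
                                       := con ⟦ 3 ⟧ :* B :- con ⟦ 2 ⟧ :* B :* (con 1ℚ :+ q))
                              refl (β r) ⟦ qrem π ⟧))
                (0≤p*q (0≤p*q (0≤⟦n⟧ 2) (0≤β r)) (+ℚ-mono-≤ (0≤⟦n⟧ 1) (0≤⟦n⟧ (qrem π))))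

lemma5 : (r : ℕ) → 1 ≤ r → (π πs : ℕ) → 1 ≤ π → 1 ≤ πs →
         (b : ℚ) → 0ℚ ≤ℚ b →
         (Safe r π πs → ΔΦΨ r π πs b ≤ℚ 0ℚ) ×
         (¬ Safe r π πs → ΔΦΨ r π πs b ≤ℚ (⟦ 3 ⟧ *ℚ β r))
-- The bounds hold for all r and π*; only π ≥ 1 is needed, so that p(π) is meaningful.
lemma5 r _ π πs 1≤π _ b 0≤b =
  (λ safe → ≤ℚ-reflexive (ΔΦΨ-safe r πs π b safe)) , ΔΦΨ-unsafe r πs π b 0≤b
  where instance
    π≢0 : NonZero π
    π≢0 = >-nonZero 1≤π
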